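{- The series $\mathbf{ni}(\mathbf{ld})$ satisfies $$\mathbf{ni}(\mathbf{ld}) = \bar{\circ}\big(\mathbf{ni}(\mathbf{ld})\big) + \bar{\bullet}\Big(\mathbf{ni}\big(\mathrm{P}^2_{\odot}(\Delta(\mathbf{ld}))\big)\Big) + \bar{\bullet}\Big(\mathrm{P}^2_{\odot}\big(\Delta(\mathbf{gr}(\mathbf{ld}))\big)\Big).$$
   Context: A duplicative tree is a planar rooted tree each of whose nodes is white or black; a duplicative forest is a finite word of duplicative trees, $\epsilon$ the empty forest, $\mathcal{D}^*$ the set of forests. For a forest $\mathfrak{g}$, $\circ(\mathfrak{g})$ (resp. $\bullet(\mathfrak{g})$) is the tree with white (resp. black) root and subtree sequence $\mathfrak{g}$; concatenation is $\mathfrak{g}\odot\mathfrak{g}'=\mathfrak{g}\mathfrak{g}'$. $\mathfrak{f}\Rightarrow_{\mathcal{D}}\mathfrak{f}'$ if $\mathfrak{f}'$ is obtained from $\mathfrak{f}$ by choosing a white node with subtree $\circ(\mathfrak{g})$ and replacing it by $\bullet(\mathfrak{g}\mathfrak{g})$; $\ll$ is its reflexive-transitive closure and $\mathcal{D}^*(\mathfrak{f}) = \{\mathfrak{f}' : \mathfrak{f}\ll\mathfrak{f}'\}$. Let $\mathbb{K}$ be a field of characteristic zero; $\mathcal{D}^*$-series are formal sums $\sum_{\mathfrak{f}}c_{\mathfrak{f}}\mathfrak{f}$ with $c_{\mathfrak{f}}\in\mathbb{K}$, and tensor series are formal sums of tensors of forests. The following operations are extended linearly to series: $\bar{\circ}(\mathfrak{f})=\circ(\mathfrak{f})$,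 $\bar{\bullet}(\mathfrak{f})=\bullet(\mathfrak{f})$; $\Delta(\mathfrak{f}) = \mathfrak{f}\otimes\mathfrak{f}$; $\mathrm{P}^2_{\odot}(\mathfrak{f}_1\otimes\mathfrak{f}_2) = \mathfrak{f}_1\mathfrak{f}_2$; $\mathbf{gr}(\mathfrak{f}) = \sum_{\mathfrak{f}'\in\mathcal{D}^*(\mathfrak{f})}\mathfrak{f}'$; $\mathbf{cv}(\mathfrak{f}) = \sum_{\mathfrak{f}' : \mathfrak{f}\Rightarrow_{\mathcal{D}}\mathfrak{f}'}\mathfrak{f}'$; and $\mathbf{ni}(\mathfrak{f}) = \mathbf{cv}(\mathbf{gr}(\mathfrak{f}))$. For $d\ge0$, $\mathfrak{l}_0=\epsilon$, $\mathfrak{l}_d=\circ(\mathfrak{l}_{d-1})$, and $\mathbf{ld}=\sum_{d\ge0}\mathfrak{l}_d$. -}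

module Defs where

open import Level using (Level; _⊔_)
open import Data.Nat using (ℕ; zero; suc)
open import Data.List using (List; []; _∷_; _++_; map; foldr)
open import Data.List.Membership.Propositional using (_∈_)
open import Data.List.Relation.Unary.Unique.Propositional using (Unique)
open import Data.Product using (Σ; ∃; _×_; _,_; proj₁; proj₂; uncurry)
open import Relation.Nullary using (¬_)
open import Relation.Binary.PropositionalEquality using (_≡_; _≢_)
open import Relation.Binary.Construct.Closure.ReflexiveTransitive using (Star)
open import Algebra.Bundles using (CommutativeRing)

data Colour : Set where
  white black : Colour

data Tree : Set where
  node : Colour → List Tree → Tree

-- duplicative forest = finite word of duplicative trees; ε = []
Forest : Set
Forest = List Tree

∘ : Forest → Tree
∘ g = node white g

• : Forest → Tree
• g = node black g

mutual
  data _⇒T_ : Tree → Tree → Set where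
    root   : ∀ {g} → ∘ g ⇒T • (g ++ g)
    inside : ∀ {c g g'} → g ⇒F g' → node c g ⇒T node c g'

  data _⇒F_ : Forest → Forest → Set where
    here  : ∀ {t t' f} → t ⇒T t' → (t ∷ f) ⇒F (t' ∷ f)
    there : ∀ {t f f'} → f ⇒F f' → (t ∷ f) ⇒F (t ∷ f')

_≪_ : Forest → Forest → Set
_≪_ = Star _⇒F_

ladder : ℕ → Forest
ladder zero    = []
ladder (suc d) = ∘ (ladder d) ∷ []

module _ {c ℓ : Level} (K : CommutativeRing c ℓ) where
  open CommutativeRing K

  natK : ℕ → Carrier
  natK zero    = 0#
  natK (suc n) = 1# + natK n

  IsFieldChar0 : Set (c ⊔ ℓ)
  IsFieldChar0 =
    (¬ (1# ≈ 0#)) ×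
    (∀ x → ¬ (x ≈ 0#) → ∃ λ y → (x * y) ≈ 1#) ×
    (∀ n → natK n ≈ 0# → n ≡ 0)

  -- D*-series and tensor series (coefficient functions)
  Series : Set c
  Series = Forest → Carrier

  TSeries : Set c
  TSeries = Forest → Forest → Carrier

  ΣL : List Carrier → Carrier
  ΣL = foldr _+_ 0#

  Enumerates : {A : Set} → (A → Set) → List A → Set
  Enumerates {A} P L = Unique L × (∀ a → (a ∈ L → P a) × (P a → a ∈ L))

  SumOver : {A : Set} → (A → Set) → (A → Carrier) → Carrier → Set ℓ
  SumOver {A} P S x = ∀ L → Enumerates P L → x ≈ ΣL (map S L)

  IsLd : Series → Set ℓ
  IsLd S = ∀ h → ((∃ λ d → ladder d ≡ h) → S h ≈ 1#)
                × ((∀ d → ladder d ≢ h) → S h ≈ 0#)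

  -- T = gr(S):  gr(f) = Σ_{f ≪ f'} f', extended linearly
  IsGr : Series → Series → Set ℓ
  IsGr S T = ∀ h → SumOver (λ f → f ≪ h) S (T h)

  -- T = cv(S):  cv(f) = Σ_{f ⇒ f'} f', extended linearly
  IsCv : Series → Series → Set ℓ
  IsCv S T = ∀ h → SumOver (λ f → f ⇒F h) S (T h)

  IsNi : Series → Series → Set (c ⊔ ℓ)
  IsNi S T = Σ Series λ G → IsGr S G × IsCv G T

  -- T = Δ(S):  Δ(f) = f ⊗ f, extended linearly
  IsΔ : Series → TSeries → Set ℓ
  IsΔ S T = ∀ f₁ f₂ → (f₁ ≡ f₂ → T f₁ f₂ ≈ S f₁) × (f₁ ≢ f₂ → T f₁ f₂ ≈ 0#)

  -- S = P²_⊙(T):  f₁ ⊗ f₂ ↦ f₁ f₂, extended linearly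
  IsP2 : TSeries → Series → Set ℓ
  IsP2 T S = ∀ h → SumOver (λ (p : Forest × Forest) → proj₁ p ++ proj₂ p ≡ h)
                           (uncurry T) (S h)

  -- ∘̄ and •̄ extended linearly: coefficient of h in ∘̄(S)
  circBar : Series → Series
  circBar S (node white g ∷ []) = S g
  circBar S (node black g ∷ []) = 0#
  circBar S []                  = 0#
  circBar S (_ ∷ _ ∷ _)         = 0#

  bulletBar : Series → Series
  bulletBar S (node black g ∷ []) = S g
  bulletBar S (node white g ∷ []) = 0#
  bulletBar S []                  = 0#
  bulletBar S (_ ∷ _ ∷ _)         = 0#

-- Rewriting preserves the number of trees and
-- ld lives on single-tree ladders, so only the coefficients at ∘(g) and •(g) are nonzero.
-- The forests f with f ⇒ ∘(g) are ∘(g′) with g′ ⇒ g; those with f ⇒ •(g) are •(g′) with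
-- g′ ⇒ g, and ∘(a) with aa = g (the root itself is rewritten). Iterating, the forests
-- f ≪ •(y) are •(g) with g ≪ y and ∘(a) with aa ≪ y. Since ld(∘ y) = ld(y), ld(• y) = 0
-- and P²_⊙(Δ(S))(f) = Σ_{aa = f} S(a), this gives gr(ld)(∘ y) = gr(ld)(y) and
-- gr(ld)(• y) = gr(P²_⊙(Δ(ld)))(y), and summing over the predecessors of ∘(g) and •(g)
-- yields the three terms of the identity.
module Submission where

open import Defs
open import Algebra.Bundles using (CommutativeRing)
open import Data.Nat as ℕ using (ℕ; zero; suc; _≤_; z≤n; s≤s; s≤s⁻¹)
open import Data.Nat.Properties
  using (≤-refl; ≤-trans; <⇒≤; ≤-<-trans; <-≤-trans; <-irrefl; m≤m+n; +-monoʳ-≤; +-monoˡ-<; +-monoʳ-<)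
open import Data.List using (List; []; _∷_; _++_; map; concat; filter; deduplicate; length)
open import Data.List.Membership.Propositional using (_∈_)
open import Data.List.Membership.Propositional.Properties
  using (∈-map⁺; ∈-map⁻; ∈-++⁺ˡ; ∈-++⁺ʳ; ∈-++⁻; ∈-concat⁺′; ∈-concat⁻′; ∈-filter⁺; ∈-filter⁻;
         ∈-deduplicate⁺; ∈-deduplicate⁻)
open import Data.List.Relation.Binary.Disjoint.Propositional using (Disjoint)
open import Data.List.Relation.Unary.Any using (here; there)
import Data.List.Relation.Unary.All as All
import Data.List.Relation.Unary.All.Properties as All
open import Data.List.Relation.Unary.AllPairs using ([]; _∷_)
open import Data.List.Relation.Unary.Unique.Propositional using (Unique)
import Data.List.Relation.Unary.Unique.Propositional.Properties as Unique
import Data.List.Relation.Unary.Unique.DecPropositional.Properties as Unique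
open import Data.Product using (∃; _×_; _,_; proj₁; proj₂; uncurry)
import Data.Product.Properties as Product
open import Data.Sum using (_⊎_; inj₁; inj₂)
open import Data.Empty using (⊥; ⊥-elim)
open import Relation.Nullary using (¬_; Dec; yes; no)
open import Relation.Unary using (Decidable; _∪_; _≐_; _⊢_)
open import Relation.Binary.Definitions using (DecidableEquality)
open import Relation.Binary.PropositionalEquality using (_≡_; refl; sym; trans; cong; subst)
open import Relation.Binary.Construct.Closure.ReflexiveTransitive using (ε; _◅_; _◅◅_; gmap)

private variable
  A B : Set
  P Q : A → Set
  L M : List A
  f f′ g g′ h a a′ b b′ : Forest
  t t′ : Tree

_≟ᶜ_ : DecidableEquality Colour
white ≟ᶜ white = yes refl
white ≟ᶜ black = no λ ()
black ≟ᶜ white = no λ ()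
black ≟ᶜ black = yes refl

mutual
  _≟ᵗ_ : DecidableEquality Tree
  node c g ≟ᵗ node c′ g′ with c ≟ᶜ c′ | g ≟ᶠ g′
  ... | yes refl | yes refl = yes refl
  ... | no c≢c′  | _        = no λ { refl → c≢c′ refl }
  ... | yes _    | no g≢g′  = no λ { refl → g≢g′ refl }

  _≟ᶠ_ : DecidableEquality Forest
  []      ≟ᶠ []        = yes refl
  []      ≟ᶠ (_ ∷ _)   = no λ ()
  (_ ∷ _) ≟ᶠ []        = no λ ()
  (t ∷ f) ≟ᶠ (t′ ∷ f′) with t ≟ᵗ t′ | f ≟ᶠ f′
  ... | yes refl | yes refl = yes refl
  ... | no t≢t′  | _        = no λ { refl → t≢t′ refl }
  ... | yes _    | no f≢f′  = no λ { refl → f≢f′ refl }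

_≟ᵖ_ : DecidableEquality (Forest × Forest)
_≟ᵖ_ = Product.≡-dec _≟ᶠ_ _≟ᶠ_

[∘_] [•_] : Forest → Forest
[∘ g ] = ∘ g ∷ []
[• g ] = • g ∷ []

[∘]-injective : [∘ g ] ≡ [∘ g′ ] → g ≡ g′
[∘]-injective refl = refl

[•]-injective : [• g ] ≡ [• g′ ] → g ≡ g′
[•]-injective refl = refl

⇒-length : f ⇒F f′ → length f ≡ length f′
⇒-length (here _)  = refl
⇒-length (there r) = cong suc (⇒-length r)

≪-length : f ≪ f′ → length f ≡ length f′
≪-length ε       = refl
≪-length (r ◅ p) = trans (⇒-length r) (≪-length p)

mutual
  blacksᵗ : Tree → ℕ
  blacksᵗ (node white g) = blacks g
  blacksᵗ (node black g) = suc (blacks g)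

  blacks : Forest → ℕ
  blacks []      = 0
  blacks (t ∷ f) = blacksᵗ t ℕ.+ blacks f

blacks-++ : ∀ a b → blacks a ≤ blacks (a ++ b)
blacks-++ []      b = z≤n
blacks-++ (t ∷ a) b = +-monoʳ-≤ (blacksᵗ t) (blacks-++ a b)

mutual
  ⇒T-blacks : t ⇒T t′ → blacksᵗ t ℕ.< blacksᵗ t′
  ⇒T-blacks (root {g})         = s≤s (blacks-++ g g)
  ⇒T-blacks (inside {white} r) = ⇒-blacks r
  ⇒T-blacks (inside {black} r) = s≤s (⇒-blacks r)

  ⇒-blacks : f ⇒F f′ → blacks f ℕ.< blacks f′
  ⇒-blacks (here {f = f} r)  = +-monoˡ-< (blacks f) (⇒T-blacks r)
  ⇒-blacks (there {t = t} r) = +-monoʳ-< (blacksᵗ t) (⇒-blacks r)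

≪-blacks : f ≪ f′ → blacks f ≤ blacks f′
≪-blacks ε       = ≤-refl
≪-blacks (r ◅ p) = ≤-trans (<⇒≤ (⇒-blacks r)) (≪-blacks p)

≪-last : f ≪ h → f ≡ h ⊎ ∃ λ h′ → f ≪ h′ × h′ ⇒F h
≪-last ε = inj₁ refl
≪-last (r ◅ p) with ≪-last p
... | inj₁ refl          = inj₂ (_ , ε , r)
... | inj₂ (h′ , q , r′) = inj₂ (h′ , r ◅ q , r′)

⇒-++ʳ : ∀ b → a ⇒F a′ → (a ++ b) ⇒F (a′ ++ b)
⇒-++ʳ b (here r)  = here r
⇒-++ʳ b (there r) = there (⇒-++ʳ b r)

⇒-++ˡ : ∀ a → b ⇒F b′ → (a ++ b) ⇒F (a ++ b′)
⇒-++ˡ []      r = r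
⇒-++ˡ (t ∷ a) r = there (⇒-++ˡ a r)

≪-node : ∀ c → g ≪ g′ → (node c g ∷ []) ≪ (node c g′ ∷ [])
≪-node c = gmap (λ g → node c g ∷ []) (λ r → here (inside r))

⇒-[∘]-inv : f ⇒F [∘ g ] → ∃ λ g′ → f ≡ [∘ g′ ] × g′ ⇒F g
⇒-[∘]-inv (here (inside r)) = _ , refl , r
⇒-[∘]-inv (there ())

⇒-[•]-inv : f ⇒F [• g ] →
  (∃ λ a → f ≡ [∘ a ] × a ++ a ≡ g) ⊎ (∃ λ g′ → f ≡ [• g′ ] × g′ ⇒F g)
⇒-[•]-inv (here root)       = inj₁ (_ , refl , refl)
⇒-[•]-inv (here (inside r)) = inj₂ (_ , refl , r)
⇒-[•]-inv (there ())

≪-[∘]-inv : f ≪ [∘ g ] → ∃ λ g′ → f ≡ [∘ g′ ] × g′ ≪ g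
≪-[∘]-inv ε = _ , refl , ε
≪-[∘]-inv (r ◅ p) with ≪-[∘]-inv p
... | _ , refl , q with ⇒-[∘]-inv r
...   | _ , refl , r′ = _ , refl , r′ ◅ q

-- A rewrite below the root of ∘(a′) ⇒ ∘(a) must be performed on both copies of a′ once
-- the root has been doubled.
≪-[•]-inv : f ≪ [• g ] →
  (∃ λ a → f ≡ [∘ a ] × (a ++ a) ≪ g) ⊎ (∃ λ g′ → f ≡ [• g′ ] × g′ ≪ g)
≪-[•]-inv ε = inj₂ (_ , refl , ε)
≪-[•]-inv (r ◅ p) with ≪-[•]-inv p
≪-[•]-inv (r ◅ p) | inj₁ (a , refl , q) with ⇒-[∘]-inv r
... | a′ , refl , r′ = inj₁ (a′ , refl , ⇒-++ʳ a′ r′ ◅ ⇒-++ˡ a r′ ◅ q)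
≪-[•]-inv (r ◅ p) | inj₂ (_ , refl , q) with ⇒-[•]-inv r
... | inj₁ (a , refl , refl) = inj₁ (a , refl , q)
... | inj₂ (_ , refl , r′)   = inj₂ (_ , refl , r′ ◅ q)

-- Defs' Enumerates, without its (unused) ring argument; the two are definitionally equal.
Enumeration : (A → Set) → List A → Set
Enumeration P L = Unique L × (∀ x → (x ∈ L → P x) × (P x → x ∈ L))

Image : (A → B) → (A → Set) → B → Set
Image w P y = ∃ λ x → y ≡ w x × P x

enumeration-resp-≐ : P ≐ Q → Enumeration P L → Enumeration Q L
enumeration-resp-≐ (P⊆Q , Q⊆P) (u , m) =
  u , λ x → (λ x∈L → P⊆Q (proj₁ (m x) x∈L)) , (λ q → proj₂ (m x) (Q⊆P q))

deduplicate-enumeration : (_≟_ : DecidableEquality A) →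
  (∀ {x} → x ∈ L → P x) → (∀ {x} → P x → x ∈ L) → Enumeration P (deduplicate _≟_ L)
deduplicate-enumeration {L = L} _≟_ sound complete =
  Unique.deduplicate-! _≟_ L ,
  λ x → (λ x∈ → sound (∈-deduplicate⁻ _≟_ L x∈)) , (λ p → ∈-deduplicate⁺ _≟_ (complete p))

map⁺-injectiveOn : {w : A → B} → (∀ {x y} → x ∈ L → y ∈ L → w x ≡ w y → x ≡ y) →
  Unique L → Unique (map w L)
map⁺-injectiveOn {L = []}    inj []        = []
map⁺-injectiveOn {L = x ∷ L} inj (x∉L ∷ u) =
  All.map⁺ (All.tabulate λ y∈L wx≡wy → All.lookup x∉L y∈L (inj (here refl) (there y∈L) wx≡wy))
  ∷ map⁺-injectiveOn (λ x∈L y∈L → inj (there x∈L) (there y∈L)) u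

map-enumeration : {w : A → B} → (∀ {x y} → w x ≡ w y → x ≡ y) →
  Enumeration P L → Enumeration (Image w P) (map w L)
map-enumeration {w = w} inj (u , m) =
  Unique.map⁺ inj u ,
  λ y → (λ y∈ → let x , x∈L , y≡wx = ∈-map⁻ w y∈ in x , y≡wx , proj₁ (m x) x∈L) ,
        (λ { (x , refl , p) → ∈-map⁺ w (proj₂ (m x) p) })

++-enumeration : Enumeration P L → Enumeration Q M → (∀ {x} → P x → Q x → ⊥) →
  Enumeration (P ∪ Q) (L ++ M)
++-enumeration {P = P} {L = L} {Q = Q} (u , m) (v , n) disjoint =
  Unique.++⁺ u v (λ (x∈L , x∈M) → disjoint (proj₁ (m _) x∈L) (proj₁ (n _) x∈M)) ,
  λ x → (λ x∈ → sound (∈-++⁻ L x∈)) ,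
        (λ { (inj₁ p) → ∈-++⁺ˡ (proj₂ (m x) p) ; (inj₂ q) → ∈-++⁺ʳ L (proj₂ (n x) q) })
  where
  sound : ∀ {x} → x ∈ L ⊎ x ∈ _ → (P ∪ Q) x
  sound (inj₁ x∈L) = inj₁ (proj₁ (m _) x∈L)
  sound (inj₂ x∈M) = inj₂ (proj₁ (n _) x∈M)

fibres-enumeration : (φ : A → B) {D : B → List A} → (∀ y → Enumeration (λ x → φ x ≡ y) (D y)) →
  Enumeration Q M → Enumeration (φ ⊢ Q) (concat (map D M))
fibres-enumeration {Q = Q} {M = M} φ {D} fibre (u , m) = unique u , λ x → sound , complete
  where
  fibre⁻ : ∀ {x y} → x ∈ D y → φ x ≡ y
  fibre⁻ {x} {y} = proj₁ (proj₂ (fibre y) x)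

  member⁻ : ∀ {x M} → x ∈ concat (map D M) → ∃ λ y → y ∈ M × x ∈ D y
  member⁻ {M = M} x∈ with ∈-concat⁻′ (map D M) x∈
  ... | _ , x∈Dy , Dy∈ with ∈-map⁻ D Dy∈
  ...   | y , y∈M , refl = y , y∈M , x∈Dy

  unique : ∀ {M} → Unique M → Unique (concat (map D M))
  unique []                = []
  unique {y ∷ M} (y∉M ∷ u) = Unique.++⁺ (proj₁ (fibre y)) (unique u) disjoint
    where
    disjoint : Disjoint (D y) (concat (map D M))
    disjoint (x∈Dy , x∈rest) with member⁻ x∈rest
    ... | y′ , y′∈M , x∈Dy′ = All.lookup y∉M y′∈M (trans (sym (fibre⁻ x∈Dy)) (fibre⁻ x∈Dy′))

  sound : ∀ {x} → x ∈ concat (map D M) → Q (φ x)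
  sound x∈ with member⁻ x∈
  ... | y , y∈M , x∈Dy = subst Q (sym (fibre⁻ x∈Dy)) (proj₁ (m y) y∈M)

  complete : ∀ {x} → Q (φ x) → x ∈ concat (map D M)
  complete {x} q = ∈-concat⁺′ (proj₂ (proj₂ (fibre (φ x)) x) refl) (∈-map⁺ D (proj₂ (m _) q))

allSplits : Forest → List (Forest × Forest)
allSplits []      = ([] , []) ∷ []
allSplits (t ∷ f) = ([] , t ∷ f) ∷ map (λ p → t ∷ proj₁ p , proj₂ p) (allSplits f)

∈-allSplits⁻ : ∀ h {p} → p ∈ allSplits h → proj₁ p ++ proj₂ p ≡ h
∈-allSplits⁻ []      (here refl) = refl
∈-allSplits⁻ (t ∷ f) (here refl) = refl
∈-allSplits⁻ (t ∷ f) (there p∈) with ∈-map⁻ (λ p → t ∷ proj₁ p , proj₂ p) p∈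
... | _ , q∈ , refl = cong (t ∷_) (∈-allSplits⁻ f q∈)

∈-allSplits⁺ : ∀ a b → (a , b) ∈ allSplits (a ++ b)
∈-allSplits⁺ []      []      = here refl
∈-allSplits⁺ []      (t ∷ b) = here refl
∈-allSplits⁺ (t ∷ a) b       = there (∈-map⁺ (λ p → t ∷ proj₁ p , proj₂ p) (∈-allSplits⁺ a b))

splits : Forest → List (Forest × Forest)
splits h = deduplicate _≟ᵖ_ (allSplits h)

splits-enumeration : ∀ h → Enumeration (λ p → proj₁ p ++ proj₂ p ≡ h) (splits h)
splits-enumeration h =
  deduplicate-enumeration _≟ᵖ_ (∈-allSplits⁻ h) λ { {a , b} refl → ∈-allSplits⁺ a b }

diagonal? : Decidable (λ (p : Forest × Forest) → proj₁ p ≡ proj₂ p)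
diagonal? p = proj₁ p ≟ᶠ proj₂ p

halves : Forest → List Forest
halves h = map proj₁ (filter diagonal? (splits h))

halves-enumeration : ∀ h → Enumeration (λ a → a ++ a ≡ h) (halves h)
halves-enumeration h =
  map⁺-injectiveOn diagonal-injective (Unique.filter⁺ diagonal? (proj₁ (splits-enumeration h))) ,
  λ a → sound , (λ a++a≡h → ∈-map⁺ proj₁ (∈-filter⁺ diagonal? (split∈ a++a≡h) refl))
  where
  split∈ : ∀ {p} → proj₁ p ++ proj₂ p ≡ h → p ∈ splits h
  split∈ {p} = proj₂ (proj₂ (splits-enumeration h) p)

  diagonal-injective : ∀ {p q} → p ∈ filter diagonal? (splits h) → q ∈ filter diagonal? (splits h) →
    proj₁ p ≡ proj₁ q → p ≡ q
  diagonal-injective p∈ q∈ refl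
    with proj₂ (∈-filter⁻ diagonal? {xs = splits h} p∈) | proj₂ (∈-filter⁻ diagonal? {xs = splits h} q∈)
  ... | refl | refl = refl

  sound : ∀ {a} → a ∈ halves h → a ++ a ≡ h
  sound a∈ with ∈-map⁻ proj₁ a∈
  ... | _ , p∈ , refl with ∈-filter⁻ diagonal? p∈
  ...   | p∈splits , refl = proj₁ (proj₂ (splits-enumeration h) _) p∈splits

mutual
  allTreePredecessors : Tree → List Tree
  allTreePredecessors (node white g) = map ∘ (allPredecessors g)
  allTreePredecessors (node black g) = map ∘ (halves g) ++ map • (allPredecessors g)

  allPredecessors : Forest → List Forest
  allPredecessors []      = []
  allPredecessors (t ∷ f) = map (_∷ f) (allTreePredecessors t) ++ map (t ∷_) (allPredecessors f)

mutual
  allTreePredecessors-sound : ∀ t → t′ ∈ allTreePredecessors t → t′ ⇒T t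
  allTreePredecessors-sound (node white g) t′∈ with ∈-map⁻ ∘ t′∈
  ... | _ , g′∈ , refl = inside (allPredecessors-sound g g′∈)
  allTreePredecessors-sound (node black g) t′∈ with ∈-++⁻ (map ∘ (halves g)) t′∈
  ... | inj₁ t′∈∘ with ∈-map⁻ ∘ t′∈∘
  ...   | a , a∈ , refl = subst (λ g → ∘ a ⇒T • g) (proj₁ (proj₂ (halves-enumeration g) a) a∈) root
  allTreePredecessors-sound (node black g) t′∈ | inj₂ t′∈• with ∈-map⁻ • t′∈•
  ...   | _ , g′∈ , refl = inside (allPredecessors-sound g g′∈)

  allPredecessors-sound : ∀ f → f′ ∈ allPredecessors f → f′ ⇒F f
  allPredecessors-sound (t ∷ f) f′∈ with ∈-++⁻ (map (_∷ f) (allTreePredecessors t)) f′∈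
  ... | inj₁ f′∈here with ∈-map⁻ (_∷ f) f′∈here
  ...   | _ , t′∈ , refl = here (allTreePredecessors-sound t t′∈)
  allPredecessors-sound (t ∷ f) f′∈ | inj₂ f′∈there with ∈-map⁻ (t ∷_) f′∈there
  ...   | _ , f″∈ , refl = there (allPredecessors-sound f f″∈)

mutual
  allTreePredecessors-complete : t′ ⇒T t → t′ ∈ allTreePredecessors t
  allTreePredecessors-complete (root {g}) =
    ∈-++⁺ˡ (∈-map⁺ ∘ (proj₂ (proj₂ (halves-enumeration (g ++ g)) g) refl))
  allTreePredecessors-complete (inside {white} r) = ∈-map⁺ ∘ (allPredecessors-complete r)
  allTreePredecessors-complete (inside {black} {g' = g} r) =
    ∈-++⁺ʳ (map ∘ (halves g)) (∈-map⁺ • (allPredecessors-complete r))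

  allPredecessors-complete : f′ ⇒F f → f′ ∈ allPredecessors f
  allPredecessors-complete (here {f = f} r) = ∈-++⁺ˡ (∈-map⁺ (_∷ f) (allTreePredecessors-complete r))
  allPredecessors-complete (there {t = t} r) =
    ∈-++⁺ʳ (map (_∷ _) (allTreePredecessors t)) (∈-map⁺ (t ∷_) (allPredecessors-complete r))

predecessors : Forest → List Forest
predecessors h = deduplicate _≟ᶠ_ (allPredecessors h)

predecessors-enumeration : ∀ h → Enumeration (_⇒F h) (predecessors h)
predecessors-enumeration h =
  deduplicate-enumeration _≟ᶠ_ (allPredecessors-sound h) allPredecessors-complete

ancestorsWithin : ℕ → Forest → List Forest
ancestorsWithin zero    h = h ∷ []
ancestorsWithin (suc n) h = h ∷ concat (map (ancestorsWithin n) (allPredecessors h))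

ancestorsWithin-sound : ∀ n h → f ∈ ancestorsWithin n h → f ≪ h
ancestorsWithin-sound zero    h (here refl) = ε
ancestorsWithin-sound (suc n) h (here refl) = ε
ancestorsWithin-sound (suc n) h (there f∈)
  with ∈-concat⁻′ (map (ancestorsWithin n) (allPredecessors h)) f∈
... | _ , f∈′ , anc∈ with ∈-map⁻ (ancestorsWithin n) anc∈
...   | _ , h′∈ , refl = ancestorsWithin-sound n _ f∈′ ◅◅ allPredecessors-sound h h′∈ ◅ ε

-- Each step adds a black node, so a path ending in h has at most (blacks h) steps.
ancestorsWithin-complete : ∀ n → f ≪ h → blacks h ≤ n ℕ.+ blacks f → f ∈ ancestorsWithin n h
ancestorsWithin-complete zero p bound with ≪-last p
... | inj₁ refl = here refl
... | inj₂ (_ , q , r) = ⊥-elim (<-irrefl refl (<-≤-trans (≤-<-trans (≪-blacks q) (⇒-blacks r)) bound))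
ancestorsWithin-complete (suc n) p bound with ≪-last p
... | inj₁ refl = here refl
... | inj₂ (_ , q , r) =
  there (∈-concat⁺′ (ancestorsWithin-complete n q (s≤s⁻¹ (≤-trans (⇒-blacks r) bound)))
                    (∈-map⁺ (ancestorsWithin n) (allPredecessors-complete r)))

ancestors : Forest → List Forest
ancestors h = deduplicate _≟ᶠ_ (ancestorsWithin (blacks h) h)

ancestors-enumeration : ∀ h → Enumeration (_≪ h) (ancestors h)
ancestors-enumeration h = deduplicate-enumeration _≟ᶠ_ (ancestorsWithin-sound (blacks h) h)
  (λ p → ancestorsWithin-complete (blacks h) p (m≤m+n (blacks h) _))

⇒-[∘]-enumeration : ∀ g → Enumeration (_⇒F [∘ g ]) (map [∘_] (predecessors g))
⇒-[∘]-enumeration g =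
  enumeration-resp-≐ ((λ { (_ , refl , r) → here (inside r) }) , ⇒-[∘]-inv)
    (map-enumeration [∘]-injective (predecessors-enumeration g))

⇒-[•]-enumeration : ∀ g → Enumeration (_⇒F [• g ]) (map [∘_] (halves g) ++ map [•_] (predecessors g))
⇒-[•]-enumeration g =
  enumeration-resp-≐ ((λ { (inj₁ (a , refl , e)) → subst (λ g → [∘ a ] ⇒F [• g ]) e (here root)
                         ; (inj₂ (_ , refl , r)) → here (inside r) }) ,
                      ⇒-[•]-inv)
    (++-enumeration (map-enumeration [∘]-injective (halves-enumeration g))
                    (map-enumeration [•]-injective (predecessors-enumeration g))
                    λ { (_ , refl , _) (_ , () , _) })

≪-[∘]-enumeration : ∀ g → Enumeration (_≪ [∘ g ]) (map [∘_] (ancestors g))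
≪-[∘]-enumeration g =
  enumeration-resp-≐ ((λ { (_ , refl , p) → ≪-node white p }) , ≪-[∘]-inv)
    (map-enumeration [∘]-injective (ancestors-enumeration g))

≪-[•]-enumeration : ∀ g →
  Enumeration (_≪ [• g ]) (map [∘_] (concat (map halves (ancestors g))) ++ map [•_] (ancestors g))
≪-[•]-enumeration g =
  enumeration-resp-≐ ((λ { (inj₁ (_ , refl , p)) → here root ◅ ≪-node black p
                         ; (inj₂ (_ , refl , p)) → ≪-node black p }) ,
                      ≪-[•]-inv)
    (++-enumeration
      (map-enumeration [∘]-injective
        (fibres-enumeration (λ a → a ++ a) halves-enumeration (ancestors-enumeration g)))
      (map-enumeration [•]-injective (ancestors-enumeration g))
      λ { (_ , refl , _) (_ , () , _) })

isLadder? : (f : Forest) → Dec (∃ λ d → ladder d ≡ f)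
isLadder? [] = yes (0 , refl)
isLadder? (node white y ∷ []) with isLadder? y
... | yes (d , p) = yes (suc d , cong [∘_] p)
... | no ¬ladder  = no λ { (zero , ()) ; (suc d , p) → ¬ladder (d , [∘]-injective p) }
isLadder? (node black y ∷ []) = no λ { (zero , ()) ; (suc d , ()) }
isLadder? (node _ y ∷ _ ∷ _)  = no λ { (zero , ()) ; (suc d , ()) }

module Coefficients {c ℓ} (K : CommutativeRing c ℓ) where
  open CommutativeRing K renaming (refl to ≈-refl; sym to ≈-sym; trans to ≈-trans)
  open import Relation.Binary.Reasoning.Setoid setoid

  private variable
    S S′ G G′ N N′ P₂ : Series K
    T : TSeries K

  ∑ : (A → Carrier) → List A → Carrier
  ∑ S xs = ΣL K (map S xs)

  ∑-++ : ∀ (S : A → Carrier) xs ys → ∑ S (xs ++ ys) ≈ ∑ S xs + ∑ S ys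
  ∑-++ S []       ys = ≈-sym (+-identityˡ _)
  ∑-++ S (x ∷ xs) ys = ≈-trans (+-congˡ (∑-++ S xs ys)) (≈-sym (+-assoc _ _ _))

  ∑-map : ∀ (S : B → Carrier) (w : A → B) xs → ∑ S (map w xs) ≈ ∑ (λ x → S (w x)) xs
  ∑-map S w []       = ≈-refl
  ∑-map S w (x ∷ xs) = +-congˡ (∑-map S w xs)

  ∑-cong : {S S′ : A → Carrier} → (∀ x → S x ≈ S′ x) → ∀ xs → ∑ S xs ≈ ∑ S′ xs
  ∑-cong S≈S′ []       = ≈-refl
  ∑-cong S≈S′ (x ∷ xs) = +-cong (S≈S′ x) (∑-cong S≈S′ xs)

  ∑-zero : {S : A → Carrier} → ∀ xs → (∀ {x} → x ∈ xs → S x ≈ 0#) → ∑ S xs ≈ 0#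
  ∑-zero []       S≈0 = ≈-refl
  ∑-zero (x ∷ xs) S≈0 = ≈-trans (+-cong (S≈0 (here refl)) (∑-zero xs λ x∈ → S≈0 (there x∈))) (+-identityˡ 0#)

  ∑-concat : ∀ (S : A → Carrier) xss → ∑ S (concat xss) ≈ ∑ (∑ S) xss
  ∑-concat S []         = ≈-refl
  ∑-concat S (xs ∷ xss) = ≈-trans (∑-++ S xs (concat xss)) (+-congˡ (∑-concat S xss))

  ∑-filter : {S S′ : A → Carrier} (P? : Decidable P) →
    (∀ {x} → P x → S x ≈ S′ x) → (∀ {x} → ¬ P x → S x ≈ 0#) → ∀ xs → ∑ S xs ≈ ∑ S′ (filter P? xs)
  ∑-filter P? kept dropped [] = ≈-refl
  ∑-filter P? kept dropped (x ∷ xs) with P? x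
  ... | yes p = +-cong (kept p) (∑-filter P? kept dropped xs)
  ... | no ¬p = ≈-trans (+-cong (dropped ¬p) (∑-filter P? kept dropped xs)) (+-identityˡ _)

  p2Δ-halves : IsΔ K S T → IsP2 K T P₂ → ∀ h → P₂ h ≈ ∑ S (halves h)
  p2Δ-halves {S} {T} {P₂} isΔ isP2 h = begin
    P₂ h                                               ≈⟨ isP2 h (splits h) (splits-enumeration h) ⟩
    ∑ (uncurry T) (splits h)                           ≈⟨ ∑-filter diagonal? (proj₁ (isΔ _ _)) (proj₂ (isΔ _ _)) (splits h) ⟩
    ∑ (λ p → S (proj₁ p)) (filter diagonal? (splits h)) ≈⟨ ∑-map S proj₁ (filter diagonal? (splits h)) ⟨
    ∑ S (halves h)                                     ∎

  ld-[∘] : IsLd K S → ∀ y → S [∘ y ] ≈ S y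
  ld-[∘] isLd y with isLadder? y
  ... | yes (d , p) = ≈-trans (proj₁ (isLd _) (suc d , cong [∘_] p)) (≈-sym (proj₁ (isLd y) (d , p)))
  ... | no ¬ladder  =
    ≈-trans (proj₂ (isLd _) λ { zero () ; (suc d) p → ¬ladder (d , [∘]-injective p) })
            (≈-sym (proj₂ (isLd y) λ d p → ¬ladder (d , p)))

  ld-[•] : IsLd K S → ∀ y → S [• y ] ≈ 0#
  ld-[•] isLd y = proj₂ (isLd _) λ { zero () ; (suc d) () }

  ld-long : IsLd K S → ∀ f → 2 ≤ length f → S f ≈ 0#
  ld-long isLd (_ ∷ _ ∷ _) _         = proj₂ (isLd _) λ { zero () ; (suc d) () }
  ld-long isLd (_ ∷ [])    (s≤s ())

  gr-long : IsGr K S G → (∀ f → 2 ≤ length f → S f ≈ 0#) → ∀ h → 2 ≤ length h → G h ≈ 0#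
  gr-long isGr S-long h long = ≈-trans (isGr h (ancestors h) e)
    (∑-zero (ancestors h) λ f∈ → S-long _ (subst (2 ≤_) (sym (≪-length (proj₁ (proj₂ e _) f∈))) long))
    where e = ancestors-enumeration h

  cv-long : IsCv K G N → (∀ f → 2 ≤ length f → G f ≈ 0#) → ∀ h → 2 ≤ length h → N h ≈ 0#
  cv-long isCv G-long h long = ≈-trans (isCv h (predecessors h) e)
    (∑-zero (predecessors h) λ f∈ → G-long _ (subst (2 ≤_) (sym (⇒-length (proj₁ (proj₂ e _) f∈))) long))
    where e = predecessors-enumeration h

  cv-[] : IsCv K G N → N [] ≈ 0#
  cv-[] isCv = isCv [] [] ([] , λ _ → (λ ()) , λ ())

  gr-[∘] : IsGr K S G → IsGr K S′ G′ → (∀ y → S [∘ y ] ≈ S′ y) → ∀ y → G [∘ y ] ≈ G′ y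
  gr-[∘] {S} {S′ = S′} {G′ = G′} isGr isGr′ S[∘] y = begin
    _                                ≈⟨ isGr [∘ y ] _ (≪-[∘]-enumeration y) ⟩
    ∑ S (map [∘_] (ancestors y))     ≈⟨ ∑-map S [∘_] (ancestors y) ⟩
    ∑ (λ x → S [∘ x ]) (ancestors y) ≈⟨ ∑-cong S[∘] (ancestors y) ⟩
    ∑ S′ (ancestors y)               ≈⟨ isGr′ y (ancestors y) (ancestors-enumeration y) ⟨
    G′ y                             ∎

  gr-[•] : IsGr K S G → IsΔ K S′ T → IsP2 K T P₂ → IsGr K P₂ G′ →
    (∀ y → S [∘ y ] ≈ S′ y) → (∀ y → S [• y ] ≈ 0#) → ∀ y → G [• y ] ≈ G′ y
  gr-[•] {S} {S′ = S′} {P₂ = P₂} {G′ = G′} isGr isΔ isP2 isGr′ S[∘] S[•] y = begin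
    _                                         ≈⟨ isGr [• y ] _ (≪-[•]-enumeration y) ⟩
    ∑ S (map [∘_] X ++ map [•_] (ancestors y)) ≈⟨ ∑-++ S (map [∘_] X) _ ⟩
    ∑ S (map [∘_] X) + ∑ S (map [•_] (ancestors y))
      ≈⟨ +-cong (≈-trans (∑-map S [∘_] X) (∑-cong S[∘] X))
                (≈-trans (∑-map S [•_] (ancestors y)) (∑-zero (ancestors y) λ _ → S[•] _)) ⟩
    ∑ S′ X + 0#                               ≈⟨ +-identityʳ _ ⟩
    ∑ S′ X                                    ≈⟨ ∑-concat S′ (map halves (ancestors y)) ⟩
    ∑ (∑ S′) (map halves (ancestors y))       ≈⟨ ∑-map (∑ S′) halves (ancestors y) ⟩
    ∑ (λ f → ∑ S′ (halves f)) (ancestors y)   ≈⟨ ∑-cong (p2Δ-halves isΔ isP2) (ancestors y) ⟨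
    ∑ P₂ (ancestors y)                        ≈⟨ isGr′ y (ancestors y) (ancestors-enumeration y) ⟨
    G′ y                                      ∎
    where X = concat (map halves (ancestors y))

  cv-[∘] : IsCv K G N → IsCv K G′ N′ → (∀ y → G [∘ y ] ≈ G′ y) → ∀ g → N [∘ g ] ≈ N′ g
  cv-[∘] {G} {G′ = G′} {N′ = N′} isCv isCv′ G[∘] g = begin
    _                                   ≈⟨ isCv [∘ g ] _ (⇒-[∘]-enumeration g) ⟩
    ∑ G (map [∘_] (predecessors g))     ≈⟨ ∑-map G [∘_] (predecessors g) ⟩
    ∑ (λ x → G [∘ x ]) (predecessors g) ≈⟨ ∑-cong G[∘] (predecessors g) ⟩
    ∑ G′ (predecessors g)               ≈⟨ isCv′ g (predecessors g) (predecessors-enumeration g) ⟨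
    N′ g                                ∎

  cv-[•] : IsCv K G N → IsΔ K G′ T → IsP2 K T P₂ → IsCv K S N′ →
    (∀ y → G [∘ y ] ≈ G′ y) → (∀ y → G [• y ] ≈ S y) → ∀ g → N [• g ] ≈ N′ g + P₂ g
  cv-[•] {G = G} {G′ = G′} {P₂ = P₂} {S = S} {N′ = N′} isCv isΔ isP2 isCv′ G[∘] G[•] g = begin
    _                                                      ≈⟨ isCv [• g ] _ (⇒-[•]-enumeration g) ⟩
    ∑ G (map [∘_] (halves g) ++ map [•_] (predecessors g)) ≈⟨ ∑-++ G (map [∘_] (halves g)) _ ⟩
    ∑ G (map [∘_] (halves g)) + ∑ G (map [•_] (predecessors g))
      ≈⟨ +-cong (≈-trans (∑-map G [∘_] (halves g)) (∑-cong G[∘] (halves g)))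
                (≈-trans (∑-map G [•_] (predecessors g)) (∑-cong G[•] (predecessors g))) ⟩
    ∑ G′ (halves g) + ∑ S (predecessors g)
      ≈⟨ +-cong (p2Δ-halves isΔ isP2 g) (isCv′ g (predecessors g) (predecessors-enumeration g)) ⟨
    P₂ g + N′ g                                            ≈⟨ +-comm _ _ ⟩
    N′ g + P₂ g                                            ∎

theorem3p3 : ∀ {c ℓ} (K : CommutativeRing c ℓ) → IsFieldChar0 K →
    let open CommutativeRing K in
    (ld niLd gLd : Series K) (ΔLd ΔgLd : TSeries K) (pΔLd niPΔLd pΔgLd : Series K) →
    IsLd K ld →
    IsNi K ld niLd →
    IsΔ K ld ΔLd → IsP2 K ΔLd pΔLd → IsNi K pΔLd niPΔLd →
    IsGr K ld gLd → IsΔ K gLd ΔgLd → IsP2 K ΔgLd pΔgLd →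
    ∀ h → niLd h ≈ (circBar K niLd h + bulletBar K niPΔLd h + bulletBar K pΔgLd h)
theorem3p3 K _ ld niLd gLd ΔLd ΔgLd pΔLd niPΔLd pΔgLd
           isLd (G , isGr , isCv) isΔ isP2 (G₂ , isGr₂ , isCv₂) isGrLd isΔg isP2g = coefficient
  where
  open CommutativeRing K using (_≈_; _+_; 0#; +-identityˡ; +-identityʳ; +-congʳ)
    renaming (sym to ≈-sym; trans to ≈-trans)
  open Coefficients K

  padded : ∀ x → x ≈ x + 0# + 0#
  padded x = ≈-sym (≈-trans (+-identityʳ _) (+-identityʳ _))

  vanishing : ∀ h → 2 ≤ length h → niLd h ≈ 0# + 0# + 0#
  vanishing h long = ≈-trans (cv-long isCv (gr-long isGr (ld-long isLd)) h long) (padded 0#)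

  coefficient : ∀ h → niLd h ≈ (circBar K niLd h + bulletBar K niPΔLd h + bulletBar K pΔgLd h)
  coefficient [] = ≈-trans (cv-[] isCv) (padded 0#)
  coefficient (node white g ∷ []) =
    ≈-trans (cv-[∘] isCv isCv (gr-[∘] isGr isGr (ld-[∘] isLd)) g) (padded (niLd g))
  coefficient (node black g ∷ []) =
    ≈-trans (cv-[•] isCv isΔg isP2g isCv₂ (gr-[∘] isGr isGrLd (ld-[∘] isLd))
                    (gr-[•] isGr isΔ isP2 isGr₂ (ld-[∘] isLd) (ld-[•] isLd)) g)
            (+-congʳ (≈-sym (+-identityˡ _)))
  coefficient h@(node white _ ∷ _ ∷ _) = vanishing h (s≤s (s≤s z≤n))
  coefficient h@(node black _ ∷ _ ∷ _) = vanishing h (s≤s (s≤s z≤n))
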